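{- Let $G$ be a belt with partition $Q_1,\ldots,Q_5,R_2,R_3$. Then: (a) For each $j\in\{2,3\}$, any two non-adjacent vertices of $R_j$ have no common neighbor in $Q_{5-j}$. (b) There is no edge between $R_2$ and $R_3$. (c) For each $j\in\{2,3\}$, every vertex of $Q_j$ that has a neighbor in $R_{5-j}$ is adjacent to every vertex of $Q_{5-j}$. (d) The graphs $G[R_2]$ and $G[R_3]$ are $(P_4,2P_3)$-free.
   Context: Graphs are finite and simple; $P_\ell$, $C_\ell$ are path and cycle on $\ell$ vertices, $2P_3$ the disjoint union of two $P_3$'s; $\mathcal F$-free means no induced subgraph isomorphic to a member of $\mathcal F$. For disjoint sets $X,Y$: $[X,Y]$ complete means every vertex of $X$ is adjacent to every vertex of $Y$; $[X,Y]$ empty means no edge between them. A belt is any $(P_6,C_4,C_6)$-free graph whose vertex set can be partitioned into seven sets $Q_1,\ldots,Q_5,R_2,R_3$ such that: each of $Q_1,\ldots,Q_5$ is a non-empty clique; $[Q_1,Q_2\cup R_2\cup Q_5]$ and $[Q_4,Q_3\cup R_3\cup Q_5]$ are complete; $[Q_1,Q_3\cup R_3\cup Q_4]$, $[Q_4,Q_2\cup R_2\cup Q_1]$ and $[Q_5,Q_2\cup R_2\cup Q_3\cup R_3]$ are empty; for each $j\in\{2,3\}$, $[Q_j,R_j]$ is complete, every vertex of $Q_j\cup R_j$ has a neighbor in $Q_{5-j}\cup R_{5-j}$, and no vertex of $R_j$ is adjacent to all other vertices of $R_j$. -}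

module Defs where

open import Data.Nat using (ℕ; zero; suc; _≡ᵇ_; _<ᵇ_)
open import Data.Bool using (Bool; true; false; _∨_; _∧_; not)
open import Data.Fin using (Fin; toℕ)
open import Data.Product using (Σ; ∃; _×_; _,_)
open import Relation.Binary.PropositionalEquality using (_≡_; _≢_)
open import Relation.Nullary using (¬_)
open import Function.Definitions using (Injective)
open import Data.Sum using (_⊎_)
open import Data.Unit using (⊤)

record Graph : Set where
  field
    n      : ℕ
    adj    : Fin n → Fin n → Bool
    sym    : ∀ u v → adj u v ≡ adj v u
    irrefl : ∀ v → adj v v ≡ false
open Graph public

Vertex : Graph → Set
Vertex G = Fin (n G)

pathAdjℕ : ℕ → ℕ → Bool
pathAdjℕ i j = (suc i ≡ᵇ j) ∨ (suc j ≡ᵇ i)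

P : (m : ℕ) → Fin m → Fin m → Bool
P m i j = pathAdjℕ (toℕ i) (toℕ j)

-- C_m : path plus the edge {0, m-1}  (used for m ≥ 4 only)
C : (m : ℕ) → Fin m → Fin m → Bool
C m i j = pathAdjℕ (toℕ i) (toℕ j)
        ∨ ((toℕ i ≡ᵇ 0) ∧ (suc (toℕ j) ≡ᵇ m))
        ∨ ((toℕ j ≡ᵇ 0) ∧ (suc (toℕ i) ≡ᵇ m))

-- 2P_3 : paths 0 - 1 - 2 and 3 - 4 - 5
twoP3 : Fin 6 → Fin 6 → Bool
twoP3 i j = pathAdjℕ (toℕ i) (toℕ j)
          ∧ (((toℕ i <ᵇ 3) ∧ (toℕ j <ᵇ 3)) ∨ (not (toℕ i <ᵇ 3) ∧ not (toℕ j <ᵇ 3)))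

InducedCopyIn : (G : Graph) → (S : Vertex G → Set) → (m : ℕ) → (Fin m → Fin m → Bool) → Set
InducedCopyIn G S m h =
  Σ (Fin m → Vertex G) λ f →
    Injective _≡_ _≡_ f × (∀ i → S (f i)) × (∀ i j → adj G (f i) (f j) ≡ h i j)

Everything : {A : Set} → A → Set
Everything _ = ⊤

FreeIn : (G : Graph) → (S : Vertex G → Set) → (m : ℕ) → (Fin m → Fin m → Bool) → Set
FreeIn G S m h = ¬ InducedCopyIn G S m h

Free : (G : Graph) → (m : ℕ) → (Fin m → Fin m → Bool) → Set
Free G m h = FreeIn G Everything m h

data Part : Set where
  Q1 Q2 Q3 Q4 Q5 R2 R3 : Part

data J : Set where
  j2 j3 : J

Qj Rj Qother Rother : J → Part
Qj j2 = Q2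
Qj j3 = Q3
Rj j2 = R2
Rj j3 = R3
Qother j2 = Q3
Qother j3 = Q2
Rother j2 = R3
Rother j3 = R2

module _ (G : Graph) (part : Vertex G → Part) where

  In : Part → Vertex G → Set
  In p v = part v ≡ p

  Clique : Part → Set
  Clique p = ∀ u v → In p u → In p v → u ≢ v → adj G u v ≡ true

  CompleteTo : (Vertex G → Set) → (Vertex G → Set) → Set
  CompleteTo X Y = ∀ u v → X u → Y v → adj G u v ≡ true

  EmptyTo : (Vertex G → Set) → (Vertex G → Set) → Set
  EmptyTo X Y = ∀ u v → X u → Y v → adj G u v ≡ false

  _∪_ : (Vertex G → Set) → (Vertex G → Set) → Vertex G → Set
  (X ∪ Y) v = X v ⊎ Y v

  record IsBelt : Set where
    field
      P6-free : Free G 6 (P 6)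
      C4-free : Free G 4 (C 4)
      C6-free : Free G 6 (C 6)
      nonempty : ∀ p → (p ≡ Q1 ⊎ p ≡ Q2 ⊎ p ≡ Q3 ⊎ p ≡ Q4 ⊎ p ≡ Q5) → ∃ λ v → In p v
      clique   : ∀ p → (p ≡ Q1 ⊎ p ≡ Q2 ⊎ p ≡ Q3 ⊎ p ≡ Q4 ⊎ p ≡ Q5) → Clique p
      Q1-complete : CompleteTo (In Q1) (In Q2 ∪ (In R2 ∪ In Q5))
      Q4-complete : CompleteTo (In Q4) (In Q3 ∪ (In R3 ∪ In Q5))
      Q1-empty : EmptyTo (In Q1) (In Q3 ∪ (In R3 ∪ In Q4))
      Q4-empty : EmptyTo (In Q4) (In Q2 ∪ (In R2 ∪ In Q1))
      Q5-empty : EmptyTo (In Q5) (In Q2 ∪ (In R2 ∪ (In Q3 ∪ In R3)))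
      QR-complete : ∀ j → CompleteTo (In (Qj j)) (In (Rj j))
      has-nbr-other : ∀ j v → (In (Qj j) ∪ In (Rj j)) v →
                        ∃ λ w → (In (Qother j) ∪ In (Rother j)) w × adj G v w ≡ true
      R-no-dominating : ∀ j v → In (Rj j) v →
                        ∃ λ w → In (Rj j) w × w ≢ v × adj G v w ≡ false

module Submission where

-- A belt is symmetric under the reflection Q1↔Q4,
-- Q2↔Q3, R2↔R3 (Q5 fixed), so each part is proved for j = 2 and transported
-- to j = 3 along the reflected belt.  Every contradiction exhibits an induced
-- C4 or P6; a small toolkit first turns "these vertices realise the pattern
-- above the diagonal" into an induced copy (injectivity is automatic for P6,
-- and needs only distinct opposite vertices for C4).  With representatives
-- q1,...,q5 of the cliques:
--   (a) non-adjacent u, v ∈ R2 with a common neighbour w ∈ Q3 give the C4 u q1 v w;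
--   for an R2–R3 edge ab and a non-neighbour a′ ∈ R2 of a, a′ ≁ b (C4 a b a′ q1)
--   and Q2 is complete to b (P6 a′ x a b q4 q5);
--   (b) an R2–R3 edge uv, non-neighbours u′, v′ of u, v and a neighbour w ∈ R3
--       of u′ yield the P6 q5 q1 u v w v′;
--   (c) v ∈ Q2 seeing w ∈ R3 but missing x ∈ Q3 gives the P6 q5 q1 v w x w′;
--   (d) by (b) each vertex of R2 has a Q3-neighbour; with these, an induced P4
--       or 2P3 inside R2 extends to an induced P6.

open import Defs
open import Data.Nat using (ℕ; zero; suc)
open import Data.Bool using (Bool; true; false)
import Data.Bool.Properties as Bool
open import Data.Fin using (Fin; zero; suc; #_)
open import Data.Fin.Properties using (all?) renaming (_≟_ to _≟ᶠ_)
open import Data.Vec using (Vec; []; _∷_; lookup)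
open import Data.Product using (∃; ∃₂; _×_; _,_; proj₁; proj₂; map₂)
open import Data.Sum using (_⊎_; inj₁; inj₂)
import Data.Sum as Sum
open import Data.Unit using (⊤; tt)
open import Data.Empty using (⊥; ⊥-elim)
open import Function using (_∘_)
open import Relation.Binary.PropositionalEquality
  using (_≡_; _≢_; refl; trans; cong) renaming (sym to ≡-sym)
open import Relation.Nullary using (¬_; yes; no)
open import Relation.Nullary.Decidable using (Dec; toWitness; _→-dec_; _⊎-dec_)

Pattern : ℕ → Set
Pattern m = Fin m → Fin m → Bool

SymmetricPattern : ∀ {m} → Pattern m → Set
SymmetricPattern h = ∀ i j → h i j ≡ h j i

Loopless : ∀ {m} → Pattern m → Set
Loopless h = ∀ i → h i i ≡ false

-- i and j have the same row; vertices identified by a copy must be twins.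
Twins : ∀ {m} → Pattern m → Fin m → Fin m → Set
Twins h i j = ∀ k → h i k ≡ h j k

twins? : ∀ {m} (h : Pattern m) i j → Dec (Twins h i j)
twins? h i j = all? λ k → h i k Bool.≟ h j k

symmetric? : ∀ {m} (h : Pattern m) → Dec (SymmetricPattern h)
symmetric? h = all? λ i → all? λ j → h i j Bool.≟ h j i

loopless? : ∀ {m} (h : Pattern m) → Dec (Loopless h)
loopless? h = all? λ i → h i i Bool.≟ false

P6-symmetric : SymmetricPattern (P 6)
P6-symmetric = toWitness {a? = symmetric? (P 6)} tt

P6-loopless : Loopless (P 6)
P6-loopless = toWitness {a? = loopless? (P 6)} tt

P6-twinFree : ∀ i j → Twins (P 6) i j → i ≡ j
P6-twinFree = toWitness {a? = all? λ i → all? λ j → twins? (P 6) i j →-dec i ≟ᶠ j} tt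

C4-symmetric : SymmetricPattern (C 4)
C4-symmetric = toWitness {a? = symmetric? (C 4)} tt

C4-loopless : Loopless (C 4)
C4-loopless = toWitness {a? = loopless? (C 4)} tt

opposite : Fin 4 → Fin 4
opposite zero = # 2
opposite (suc zero) = # 3
opposite (suc (suc zero)) = # 0
opposite (suc (suc (suc zero))) = # 1

C4-twins : ∀ i j → Twins (C 4) i j → i ≡ j ⊎ j ≡ opposite i
C4-twins = toWitness
  {a? = all? λ i → all? λ j → twins? (C 4) i j →-dec (i ≟ᶠ j ⊎-dec j ≟ᶠ opposite i)} tt

AllFin : ∀ {m} → (Fin m → Set) → Set
AllFin {zero} P = ⊤
AllFin {suc zero} P = P zero
AllFin {suc (suc m)} P = P zero × AllFin (P ∘ suc)

lookupAll : ∀ {m} {P : Fin m → Set} → AllFin P → ∀ i → P i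
lookupAll {suc zero} p zero = p
lookupAll {suc (suc m)} (p , ps) zero = p
lookupAll {suc (suc m)} (p , ps) (suc i) = lookupAll ps i

module Copies (G : Graph) where

  -- f realises h on every pair i < j, listed row by row.
  AgreesAbove : ∀ {m} → (Fin m → Vertex G) → Pattern m → Set
  AgreesAbove {zero} f h = ⊤
  AgreesAbove {suc zero} f h = ⊤
  AgreesAbove {suc (suc m)} f h =
    AllFin (λ j → adj G (f zero) (f (suc j)) ≡ h zero (suc j))
    × AgreesAbove (f ∘ suc) (λ i j → h (suc i) (suc j))

  agreement : ∀ {m} (f : Fin m → Vertex G) (h : Pattern m) →
    SymmetricPattern h → Loopless h → AgreesAbove f h → ∀ i j → adj G (f i) (f j) ≡ h i j
  agreement {suc zero} f h _ loop _ zero zero = trans (irrefl G (f zero)) (≡-sym (loop zero))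
  agreement {suc (suc m)} f h _ loop _ zero zero = trans (irrefl G (f zero)) (≡-sym (loop zero))
  agreement {suc (suc m)} f h _ _ (row , _) zero (suc j) = lookupAll row j
  agreement {suc (suc m)} f h hsym _ (row , _) (suc i) zero =
    trans (Graph.sym G (f (suc i)) (f zero)) (trans (lookupAll row i) (hsym zero (suc i)))
  agreement {suc (suc m)} f h hsym loop (_ , rest) (suc i) (suc j) =
    agreement (f ∘ suc) (λ i j → h (suc i) (suc j))
      (λ i j → hsym (suc i) (suc j)) (λ i → loop (suc i)) rest i j

  collapse : ∀ {m} {f : Fin m → Vertex G} {h : Pattern m} →
    (∀ i j → adj G (f i) (f j) ≡ h i j) → ∀ {i j} → f i ≡ f j → Twins h i j
  collapse {f = f} agrees {i} {j} fi≡fj k =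
    trans (≡-sym (agrees i k)) (trans (cong (λ x → adj G x (f k)) fi≡fj) (agrees j k))

  inducedCopy : ∀ {m} (f : Fin m → Vertex G) (h : Pattern m) →
    SymmetricPattern h → Loopless h → AgreesAbove f h →
    (∀ i j → Twins h i j → f i ≡ f j → i ≡ j) → InducedCopyIn G Everything m h
  inducedCopy f h hsym loop above separated = f , injective , (λ _ → tt) , agrees
    where
    agrees : ∀ i j → adj G (f i) (f j) ≡ h i j
    agrees = agreement f h hsym loop above
    injective : ∀ {i j} → f i ≡ f j → i ≡ j
    injective fi≡fj = separated _ _ (collapse agrees fi≡fj) fi≡fj

  path6 : (v : Vec (Vertex G) 6) → AgreesAbove (lookup v) (P 6) →
    InducedCopyIn G Everything 6 (P 6)
  path6 v above =
    inducedCopy (lookup v) (P 6) P6-symmetric P6-loopless above (λ i j twins _ → P6-twinFree i j twins)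

  cycle4 : (v : Vec (Vertex G) 4) → AgreesAbove (lookup v) (C 4) →
    lookup v (# 0) ≢ lookup v (# 2) → lookup v (# 1) ≢ lookup v (# 3) →
    InducedCopyIn G Everything 4 (C 4)
  cycle4 v above d02 d13 = inducedCopy (lookup v) (C 4) C4-symmetric C4-loopless above separated
    where
    apart : ∀ i → lookup v i ≢ lookup v (opposite i)
    apart zero = d02
    apart (suc zero) = d13
    apart (suc (suc zero)) = d02 ∘ ≡-sym
    apart (suc (suc (suc zero))) = d13 ∘ ≡-sym
    separated : ∀ i j → Twins (C 4) i j → lookup v i ≡ lookup v j → i ≡ j
    separated i j twins eq with C4-twins i j twins
    ... | inj₁ i≡j = i≡j
    ... | inj₂ refl = ⊥-elim (apart i eq)

freeIn-mono : ∀ {G : Graph} {S T : Vertex G → Set} {m} {h : Pattern m} →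
  (∀ v → S v → T v) → FreeIn G T m h → FreeIn G S m h
freeIn-mono S⊆T T-free (f , inj , inS , agrees) = T-free (f , inj , (λ i → S⊆T (f i) (inS i)) , agrees)

module Adjacency (G : Graph) where

  _~_ : Vertex G → Vertex G → Set
  u ~ v = adj G u v ≡ true

  _≁_ : Vertex G → Vertex G → Set
  u ≁ v = adj G u v ≡ false

  adj-comm : ∀ {u v b} → adj G u v ≡ b → adj G v u ≡ b
  adj-comm {u} {v} e = trans (Graph.sym G v u) e

  nonEdge : ∀ {u v} → ¬ (u ~ v) → u ≁ v
  nonEdge = Bool.¬-not {y = true}

  edge : ∀ {u v} → ¬ (u ≁ v) → u ~ v
  edge = Bool.¬-not {y = false}

  adjacent? : ∀ u v → u ~ v ⊎ u ≁ v
  adjacent? u v with adj G u v Bool.≟ true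
  ... | yes e = inj₁ e
  ... | no ne = inj₂ (nonEdge ne)

  edge-nonEdge : ∀ {u v} → u ~ v → u ≁ v → ⊥
  edge-nonEdge uv uv′ with trans (≡-sym uv) uv′
  ... | ()

  separatedBy : ∀ {x a b} → x ~ a → x ≁ b → a ≢ b
  separatedBy xa xb refl = edge-nonEdge xa xb

mirror : Part → Part
mirror Q1 = Q4
mirror Q2 = Q3
mirror Q3 = Q2
mirror Q4 = Q1
mirror Q5 = Q5
mirror R2 = R3
mirror R3 = R2

mirror-involutive : ∀ p → mirror (mirror p) ≡ p
mirror-involutive Q1 = refl
mirror-involutive Q2 = refl
mirror-involutive Q3 = refl
mirror-involutive Q4 = refl
mirror-involutive Q5 = refl
mirror-involutive R2 = refl
mirror-involutive R3 = refl

IsClique : Part → Set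
IsClique p = p ≡ Q1 ⊎ p ≡ Q2 ⊎ p ≡ Q3 ⊎ p ≡ Q4 ⊎ p ≡ Q5

mirror-clique : ∀ {p} → IsClique p → IsClique (mirror p)
mirror-clique (inj₁ refl) = inj₂ (inj₂ (inj₂ (inj₁ refl)))
mirror-clique (inj₂ (inj₁ refl)) = inj₂ (inj₂ (inj₁ refl))
mirror-clique (inj₂ (inj₂ (inj₁ refl))) = inj₂ (inj₁ refl)
mirror-clique (inj₂ (inj₂ (inj₂ (inj₁ refl)))) = inj₁ refl
mirror-clique (inj₂ (inj₂ (inj₂ (inj₂ refl)))) = inj₂ (inj₂ (inj₂ (inj₂ refl)))

module Mirror (G : Graph) (part : Vertex G → Part) (B : IsBelt G part) where
  open IsBelt B

  part′ : Vertex G → Part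
  part′ = mirror ∘ part

  to′ : ∀ {p v} → In G part (mirror p) v → In G part′ p v
  to′ {p} e = trans (cong mirror e) (mirror-involutive p)

  from′ : ∀ {p v} → In G part′ p v → In G part (mirror p) v
  from′ {v = v} e = trans (≡-sym (mirror-involutive (part v))) (cong mirror e)

  -- the reflected belt: every axiom is its own mirror image or that of its partner
  belt′ : IsBelt G part′
  belt′ = record
    { P6-free = P6-free
    ; C4-free = C4-free
    ; C6-free = C6-free
    ; nonempty = λ p isQ → map₂ to′ (nonempty (mirror p) (mirror-clique isQ))
    ; clique = λ p isQ u v hu hv → clique (mirror p) (mirror-clique isQ) u v (from′ hu) (from′ hv)
    ; Q1-complete = λ u v hu hv → Q4-complete u v (from′ hu) (from3 hv)
    ; Q4-complete = λ u v hu hv → Q1-complete u v (from′ hu) (from3 hv)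
    ; Q1-empty = λ u v hu hv → Q4-empty u v (from′ hu) (from3 hv)
    ; Q4-empty = λ u v hu hv → Q1-empty u v (from′ hu) (from3 hv)
    ; Q5-empty = λ u v hu hv → Q5-empty u v (from′ hu) (swapSides hv)
    ; QR-complete = λ { j2 u v hu hv → QR-complete j3 u v (from′ hu) (from′ hv)
                      ; j3 u v hu hv → QR-complete j2 u v (from′ hu) (from′ hv) }
    ; has-nbr-other = λ
        { j2 v hv → reflectNbr (has-nbr-other j3 v (Sum.map from′ from′ hv))
        ; j3 v hv → reflectNbr (has-nbr-other j2 v (Sum.map from′ from′ hv)) }
    ; R-no-dominating = λ
        { j2 v hv → reflectNonNbr (R-no-dominating j3 v (from′ hv))
        ; j3 v hv → reflectNonNbr (R-no-dominating j2 v (from′ hv)) }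
    }
    where
    from3 : ∀ {p q r v} → In G part′ p v ⊎ In G part′ q v ⊎ In G part′ r v →
      In G part (mirror p) v ⊎ In G part (mirror q) v ⊎ In G part (mirror r) v
    from3 = Sum.map from′ (Sum.map from′ from′)
    swapSides : ∀ {v} → In G part′ Q2 v ⊎ In G part′ R2 v ⊎ In G part′ Q3 v ⊎ In G part′ R3 v →
      In G part Q2 v ⊎ In G part R2 v ⊎ In G part Q3 v ⊎ In G part R3 v
    swapSides (inj₁ x) = inj₂ (inj₂ (inj₁ (from′ x)))
    swapSides (inj₂ (inj₁ x)) = inj₂ (inj₂ (inj₂ (from′ x)))
    swapSides (inj₂ (inj₂ (inj₁ x))) = inj₁ (from′ x)
    swapSides (inj₂ (inj₂ (inj₂ x))) = inj₂ (inj₁ (from′ x))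
    reflectNbr : ∀ {p q v} → ∃ (λ w → (In G part (mirror p) w ⊎ In G part (mirror q) w) × adj G v w ≡ true) →
      ∃ λ w → (In G part′ p w ⊎ In G part′ q w) × adj G v w ≡ true
    reflectNbr (w , hw , vw) = w , Sum.map to′ to′ hw , vw
    reflectNonNbr : ∀ {p v} → ∃ (λ w → In G part (mirror p) w × w ≢ v × adj G v w ≡ false) →
      ∃ λ w → In G part′ p w × w ≢ v × adj G v w ≡ false
    reflectNonNbr (w , hw , w≢v , vw) = w , to′ hw , w≢v , vw

module Basics (G : Graph) (part : Vertex G → Part) (B : IsBelt G part) where
  open IsBelt B
  open Copies G
  open Adjacency G

  V : Set
  V = Vertex G

  _∈_ : V → Part → Set
  v ∈ p = In G part p v

  representative : ∀ p → IsClique p → V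
  representative p isQ = proj₁ (nonempty p isQ)

  q1 q2 q3 q4 q5 : V
  q1 = representative Q1 (inj₁ refl)
  q2 = representative Q2 (inj₂ (inj₁ refl))
  q3 = representative Q3 (inj₂ (inj₂ (inj₁ refl)))
  q4 = representative Q4 (inj₂ (inj₂ (inj₂ (inj₁ refl))))
  q5 = representative Q5 (inj₂ (inj₂ (inj₂ (inj₂ refl))))

  q1∈Q1 : q1 ∈ Q1
  q1∈Q1 = proj₂ (nonempty Q1 (inj₁ refl))
  q2∈Q2 : q2 ∈ Q2
  q2∈Q2 = proj₂ (nonempty Q2 (inj₂ (inj₁ refl)))
  q3∈Q3 : q3 ∈ Q3
  q3∈Q3 = proj₂ (nonempty Q3 (inj₂ (inj₂ (inj₁ refl))))
  q4∈Q4 : q4 ∈ Q4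
  q4∈Q4 = proj₂ (nonempty Q4 (inj₂ (inj₂ (inj₂ (inj₁ refl)))))
  q5∈Q5 : q5 ∈ Q5
  q5∈Q5 = proj₂ (nonempty Q5 (inj₂ (inj₂ (inj₂ (inj₂ refl)))))

  apartParts : ∀ {p p′ u v} → u ∈ p → v ∈ p′ → p ≢ p′ → u ≢ v
  apartParts u∈p v∈p′ p≢p′ refl = p≢p′ (trans (≡-sym u∈p) v∈p′)

  Q1~Q2 : ∀ {u v} → u ∈ Q1 → v ∈ Q2 → u ~ v
  Q1~Q2 hu hv = Q1-complete _ _ hu (inj₁ hv)
  Q1~R2 : ∀ {u v} → u ∈ Q1 → v ∈ R2 → u ~ v
  Q1~R2 hu hv = Q1-complete _ _ hu (inj₂ (inj₁ hv))
  Q1~Q5 : ∀ {u v} → u ∈ Q1 → v ∈ Q5 → u ~ v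
  Q1~Q5 hu hv = Q1-complete _ _ hu (inj₂ (inj₂ hv))
  Q4~Q3 : ∀ {u v} → u ∈ Q4 → v ∈ Q3 → u ~ v
  Q4~Q3 hu hv = Q4-complete _ _ hu (inj₁ hv)
  Q4~R3 : ∀ {u v} → u ∈ Q4 → v ∈ R3 → u ~ v
  Q4~R3 hu hv = Q4-complete _ _ hu (inj₂ (inj₁ hv))
  Q4~Q5 : ∀ {u v} → u ∈ Q4 → v ∈ Q5 → u ~ v
  Q4~Q5 hu hv = Q4-complete _ _ hu (inj₂ (inj₂ hv))
  Q2~R2 : ∀ {u v} → u ∈ Q2 → v ∈ R2 → u ~ v
  Q2~R2 = QR-complete j2 _ _
  Q3~R3 : ∀ {u v} → u ∈ Q3 → v ∈ R3 → u ~ v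
  Q3~R3 = QR-complete j3 _ _
  Q3~Q3 : ∀ {u v} → u ∈ Q3 → v ∈ Q3 → u ≢ v → u ~ v
  Q3~Q3 = clique Q3 (inj₂ (inj₂ (inj₁ refl))) _ _
  Q1≁Q3 : ∀ {u v} → u ∈ Q1 → v ∈ Q3 → u ≁ v
  Q1≁Q3 hu hv = Q1-empty _ _ hu (inj₁ hv)
  Q1≁R3 : ∀ {u v} → u ∈ Q1 → v ∈ R3 → u ≁ v
  Q1≁R3 hu hv = Q1-empty _ _ hu (inj₂ (inj₁ hv))
  Q4≁Q2 : ∀ {u v} → u ∈ Q4 → v ∈ Q2 → u ≁ v
  Q4≁Q2 hu hv = Q4-empty _ _ hu (inj₁ hv)
  Q4≁R2 : ∀ {u v} → u ∈ Q4 → v ∈ R2 → u ≁ v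
  Q4≁R2 hu hv = Q4-empty _ _ hu (inj₂ (inj₁ hv))
  Q5≁Q2 : ∀ {u v} → u ∈ Q5 → v ∈ Q2 → u ≁ v
  Q5≁Q2 hu hv = Q5-empty _ _ hu (inj₁ hv)
  Q5≁R2 : ∀ {u v} → u ∈ Q5 → v ∈ R2 → u ≁ v
  Q5≁R2 hu hv = Q5-empty _ _ hu (inj₂ (inj₁ hv))
  Q5≁Q3 : ∀ {u v} → u ∈ Q5 → v ∈ Q3 → u ≁ v
  Q5≁Q3 hu hv = Q5-empty _ _ hu (inj₂ (inj₂ (inj₁ hv)))
  Q5≁R3 : ∀ {u v} → u ∈ Q5 → v ∈ R3 → u ≁ v
  Q5≁R3 hu hv = Q5-empty _ _ hu (inj₂ (inj₂ (inj₂ hv)))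

  -- (a) for j = 2: a common neighbour w ∈ Q3 would close the induced C4 u q1 v w.
  R2-noCommonQ3 : ∀ {u v w} → u ∈ R2 → v ∈ R2 → u ≢ v → u ≁ v →
    w ∈ Q3 → u ~ w → v ~ w → ⊥
  R2-noCommonQ3 {u} {v} {w} hu hv u≢v uv hw uw vw = C4-free (cycle4 (u ∷ q1 ∷ v ∷ w ∷ [])
    ( (adj-comm (Q1~R2 q1∈Q1 hu) , uv , uw)
    , (Q1~R2 q1∈Q1 hv , Q1≁Q3 q1∈Q1 hw)
    , vw , tt)
    u≢v (apartParts q1∈Q1 hw λ ()))

  -- Let ab be an edge from R2 to R3 and a′ ∈ R2 a non-neighbour of a.
  -- Then a′ ≁ b, since otherwise a b a′ q1 is an induced C4 ...
  crossEdge-private : ∀ {a b a′} → a ∈ R2 → b ∈ R3 → a ~ b → a′ ∈ R2 → a ≢ a′ → a ≁ a′ → a′ ≁ b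
  crossEdge-private {a} {b} {a′} ha hb ab ha′ a≢a′ aa′ = nonEdge λ a′b → C4-free (cycle4 (a ∷ b ∷ a′ ∷ q1 ∷ [])
    ( (ab , aa′ , adj-comm (Q1~R2 q1∈Q1 ha))
    , (adj-comm a′b , adj-comm (Q1≁R3 q1∈Q1 hb))
    , adj-comm (Q1~R2 q1∈Q1 ha′) , tt)
    a≢a′ (apartParts hb q1∈Q1 λ ()))

  -- ... and every x ∈ Q2 is adjacent to b, since otherwise a′ x a b q4 q5 is an induced P6.
  crossEdge-Q2 : ∀ {a b a′ x} → a ∈ R2 → b ∈ R3 → a ~ b → a′ ∈ R2 → a ≢ a′ → a ≁ a′ →
    x ∈ Q2 → x ~ b
  crossEdge-Q2 {a} {b} {a′} {x} ha hb ab ha′ a≢a′ aa′ hx = edge λ xb → P6-free (path6 (a′ ∷ x ∷ a ∷ b ∷ q4 ∷ q5 ∷ [])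
    ( ( adj-comm (Q2~R2 hx ha′) , adj-comm aa′ , crossEdge-private ha hb ab ha′ a≢a′ aa′
      , adj-comm (Q4≁R2 q4∈Q4 ha′) , adj-comm (Q5≁R2 q5∈Q5 ha′))
    , (Q2~R2 hx ha , xb , adj-comm (Q4≁Q2 q4∈Q4 hx) , adj-comm (Q5≁Q2 q5∈Q5 hx))
    , (ab , adj-comm (Q4≁R2 q4∈Q4 ha) , adj-comm (Q5≁R2 q5∈Q5 ha))
    , (adj-comm (Q4~R3 q4∈Q4 hb) , adj-comm (Q5≁R3 q5∈Q5 hb))
    , Q4~Q5 q4∈Q4 q5∈Q5 , tt))

module Consequences (G : Graph) (part : Vertex G → Part) (B : IsBelt G part) where
  open IsBelt B
  open Copies G
  open Adjacency G
  open Basics G part B public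
  open Mirror G part B
  private module M = Basics G part′ belt′

  R3-noCommonQ2 : ∀ {u v w} → u ∈ R3 → v ∈ R3 → u ≢ v → u ≁ v →
    w ∈ Q2 → u ~ w → v ~ w → ⊥
  R3-noCommonQ2 hu hv u≢v uv hw = M.R2-noCommonQ3 (to′ hu) (to′ hv) u≢v uv (to′ hw)

  crossEdge-private′ : ∀ {a b a′} → a ∈ R3 → b ∈ R2 → a ~ b → a′ ∈ R3 → a ≢ a′ → a ≁ a′ → a′ ≁ b
  crossEdge-private′ ha hb ab ha′ = M.crossEdge-private (to′ ha) (to′ hb) ab (to′ ha′)

  crossEdge-Q3 : ∀ {a b a′ x} → a ∈ R3 → b ∈ R2 → a ~ b → a′ ∈ R3 → a ≢ a′ → a ≁ a′ →
    x ∈ Q3 → x ~ b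
  crossEdge-Q3 ha hb ab ha′ a≢a′ aa′ hx =
    M.crossEdge-Q2 (to′ ha) (to′ hb) ab (to′ ha′) a≢a′ aa′ (to′ hx)

  module CrossEdge {u v u′ v′ : V} (hu : u ∈ R2) (hv : v ∈ R3) (uv : u ~ v)
      (hu′ : u′ ∈ R2) (u≢u′ : u ≢ u′) (uu′ : u ≁ u′)
      (hv′ : v′ ∈ R3) (v≢v′ : v ≢ v′) (vv′ : v ≁ v′) where

    v′u : v′ ≁ u
    v′u = crossEdge-private′ hv hu (adj-comm uv) hv′ v≢v′ vv′

    -- Q3 is complete to u, so a Q3-neighbour of u′ would be common to u and u′
    u′-noQ3 : ∀ {x} → x ∈ Q3 → u′ ≁ x
    u′-noQ3 hx = nonEdge λ u′x → R2-noCommonQ3 hu hu′ u≢u′ uu′ hx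
      (adj-comm (crossEdge-Q3 hv hu (adj-comm uv) hv′ v≢v′ vv′ hx)) u′x

    -- hence u′ has a neighbour w ∈ R3, which is impossible
    module _ {w : V} (hw : w ∈ R3) (u′w : u′ ~ w) where

      uw : u ≁ w
      uw = crossEdge-private hu′ hw u′w hu (u≢u′ ∘ ≡-sym) (adj-comm uu′)

      q2w : q2 ~ w
      q2w = crossEdge-Q2 hu′ hw u′w hu (u≢u′ ∘ ≡-sym) (adj-comm uu′) q2∈Q2

      q2v : q2 ~ v
      q2v = crossEdge-Q2 hu hv uv hu′ u≢u′ uu′ q2∈Q2

      -- otherwise q2 is a common Q2-neighbour of the non-adjacent v, w ∈ R3
      vw : v ~ w
      vw = edge λ v≁w → R3-noCommonQ2 hv hw (separatedBy uv uw) v≁w q2∈Q2 (adj-comm q2v) (adj-comm q2w)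

      q2v′ : q2 ≁ v′
      q2v′ = nonEdge λ q2~v′ → R3-noCommonQ2 hv hv′ v≢v′ vv′ q2∈Q2 (adj-comm q2v) (adj-comm q2~v′)

      -- otherwise u q2 u′ v′ q4 q5 is an induced P6
      u′v′ : u′ ≁ v′
      u′v′ = nonEdge λ u′~v′ → P6-free (path6 (u ∷ q2 ∷ u′ ∷ v′ ∷ q4 ∷ q5 ∷ [])
        ( ( adj-comm (Q2~R2 q2∈Q2 hu) , uu′ , adj-comm v′u
          , adj-comm (Q4≁R2 q4∈Q4 hu) , adj-comm (Q5≁R2 q5∈Q5 hu))
        , (Q2~R2 q2∈Q2 hu′ , q2v′ , adj-comm (Q4≁Q2 q4∈Q4 q2∈Q2) , adj-comm (Q5≁Q2 q5∈Q5 q2∈Q2))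
        , (u′~v′ , adj-comm (Q4≁R2 q4∈Q4 hu′) , adj-comm (Q5≁R2 q5∈Q5 hu′))
        , (adj-comm (Q4~R3 q4∈Q4 hv′) , adj-comm (Q5≁R3 q5∈Q5 hv′))
        , Q4~Q5 q4∈Q4 q5∈Q5 , tt))

      -- otherwise v′ q3 w u′ q1 q5 is an induced P6
      wv′ : w ~ v′
      wv′ = edge λ w≁v′ → P6-free (path6 (v′ ∷ q3 ∷ w ∷ u′ ∷ q1 ∷ q5 ∷ [])
        ( ( adj-comm (Q3~R3 q3∈Q3 hv′) , adj-comm w≁v′ , adj-comm u′v′
          , adj-comm (Q1≁R3 q1∈Q1 hv′) , adj-comm (Q5≁R3 q5∈Q5 hv′))
        , ( Q3~R3 q3∈Q3 hw , adj-comm (u′-noQ3 q3∈Q3)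
          , adj-comm (Q1≁Q3 q1∈Q1 q3∈Q3) , adj-comm (Q5≁Q3 q5∈Q5 q3∈Q3))
        , (adj-comm u′w , adj-comm (Q1≁R3 q1∈Q1 hw) , adj-comm (Q5≁R3 q5∈Q5 hw))
        , (adj-comm (Q1~R2 q1∈Q1 hu′) , adj-comm (Q5≁R2 q5∈Q5 hu′))
        , Q1~Q5 q1∈Q1 q5∈Q5 , tt))

      impossible : ⊥
      impossible = P6-free (path6 (q5 ∷ q1 ∷ u ∷ v ∷ w ∷ v′ ∷ [])
        ( ( adj-comm (Q1~Q5 q1∈Q1 q5∈Q5) , Q5≁R2 q5∈Q5 hu , Q5≁R3 q5∈Q5 hv
          , Q5≁R3 q5∈Q5 hw , Q5≁R3 q5∈Q5 hv′)
        , (Q1~R2 q1∈Q1 hu , Q1≁R3 q1∈Q1 hv , Q1≁R3 q1∈Q1 hw , Q1≁R3 q1∈Q1 hv′)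
        , (uv , uw , adj-comm v′u)
        , (vw , vv′)
        , wv′ , tt))

  R2≁R3 : ∀ {u v} → u ∈ R2 → v ∈ R3 → u ≁ v
  R2≁R3 {u} {v} hu hv = nonEdge λ uv →
    refute uv (R-no-dominating j2 u hu) (R-no-dominating j3 v hv)
    where
    refute : u ~ v → ∃ (λ u′ → u′ ∈ R2 × u′ ≢ u × u ≁ u′) →
      ∃ (λ v′ → v′ ∈ R3 × v′ ≢ v × v ≁ v′) → ⊥
    refute uv (u′ , hu′ , u′≢u , uu′) (v′ , hv′ , v′≢v , vv′) = lastStep (has-nbr-other j2 u′ (inj₂ hu′))
      where
      module Edge = CrossEdge hu hv uv hu′ (u′≢u ∘ ≡-sym) uu′ hv′ (v′≢v ∘ ≡-sym) vv′
      lastStep : ∃ (λ w → (w ∈ Q3 ⊎ w ∈ R3) × u′ ~ w) → ⊥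
      lastStep (w , inj₁ hw , u′w) = edge-nonEdge u′w (Edge.u′-noQ3 hw)
      lastStep (w , inj₂ hw , u′w) = Edge.impossible hw u′w

  -- (c) for j = 2.  If v ∈ Q2 has a neighbour w ∈ R3 but misses x ∈ Q3, pick a
  -- non-neighbour w′ ∈ R3 of w; then q5 q1 v w x w′ is an induced P6.
  Q2-reaching-R3 : ∀ {v w x} → v ∈ Q2 → w ∈ R3 → v ~ w → x ∈ Q3 → v ~ x
  Q2-reaching-R3 {v} {w} {x} hv hw vw hx = edge λ vx → refute vx (R-no-dominating j3 w hw)
    where
    refute : v ≁ x → ∃ (λ w′ → w′ ∈ R3 × w′ ≢ w × w ≁ w′) → ⊥
    refute vx (w′ , hw′ , w′≢w , ww′) = P6-free (path6 (q5 ∷ q1 ∷ v ∷ w ∷ x ∷ w′ ∷ [])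
      ( ( adj-comm (Q1~Q5 q1∈Q1 q5∈Q5) , Q5≁Q2 q5∈Q5 hv , Q5≁R3 q5∈Q5 hw
        , Q5≁Q3 q5∈Q5 hx , Q5≁R3 q5∈Q5 hw′)
      , (Q1~Q2 q1∈Q1 hv , Q1≁R3 q1∈Q1 hw , Q1≁Q3 q1∈Q1 hx , Q1≁R3 q1∈Q1 hw′)
      , (vw , vx , vw′)
      , (adj-comm (Q3~R3 hx hw) , ww′)
      , Q3~R3 hx hw′ , tt))
      where
      -- v would be a common Q2-neighbour of the non-adjacent w, w′ ∈ R3
      vw′ : v ≁ w′
      vw′ = nonEdge λ v~w′ → R3-noCommonQ2 hw hw′ (w′≢w ∘ ≡-sym) ww′ hv (adj-comm vw) (adj-comm v~w′)

  -- By (b), the neighbour of a ∈ R2 in Q3 ∪ R3 lies in Q3.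
  R2-nbrQ3 : ∀ {a} → a ∈ R2 → ∃ λ x → x ∈ Q3 × a ~ x
  R2-nbrQ3 {a} ha with has-nbr-other j2 a (inj₂ ha)
  ... | x , inj₁ hx , ax = x , hx , ax
  ... | x , inj₂ hx , ax = ⊥-elim (edge-nonEdge ax (R2≁R3 ha hx))

  Q3-private : ∀ {a c x} → a ∈ R2 → c ∈ R2 → a ≢ c → a ≁ c → x ∈ Q3 → a ~ x → c ≁ x
  Q3-private ha hc a≢c ac hx ax = nonEdge (R2-noCommonQ3 ha hc a≢c ac hx ax)

  noQ3-led-P4 : ∀ {x y z t} → x ∈ Q3 → y ∈ R2 → z ∈ R2 → t ∈ R2 →
    x ~ y → x ≁ z → x ≁ t → y ~ z → y ≁ t → z ~ t → ⊥
  noQ3-led-P4 {x} {y} {z} {t} hx hy hz ht xy xz xt yz yt zt = P6-free (path6 (q5 ∷ q4 ∷ x ∷ y ∷ z ∷ t ∷ [])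
    ( ( adj-comm (Q4~Q5 q4∈Q4 q5∈Q5) , Q5≁Q3 q5∈Q5 hx , Q5≁R2 q5∈Q5 hy
      , Q5≁R2 q5∈Q5 hz , Q5≁R2 q5∈Q5 ht)
    , (Q4~Q3 q4∈Q4 hx , Q4≁R2 q4∈Q4 hy , Q4≁R2 q4∈Q4 hz , Q4≁R2 q4∈Q4 ht)
    , (xy , xz , xt)
    , (yz , yt)
    , zt , tt))

  -- (d), P4.  For an induced P4 a b c d in R2 and a Q3-neighbour x of a, x misses c and d,
  -- so x b c d (if x ~ b) or x a b c (otherwise) is an induced P4 led by x.
  R2-P4-free : FreeIn G (_∈ R2) 4 (P 4)
  R2-P4-free (f , inj , inR2 , agrees) = leadBy (R2-nbrQ3 (inR2 (# 0)))
    where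
    leadBy : ∃ (λ x → x ∈ Q3 × f (# 0) ~ x) → ⊥
    leadBy (x , hx , ax) = extend (adjacent? (f (# 1)) x)
      where
      cx : f (# 2) ≁ x
      cx = Q3-private (inR2 (# 0)) (inR2 (# 2)) ((λ ()) ∘ inj) (agrees (# 0) (# 2)) hx ax
      dx : f (# 3) ≁ x
      dx = Q3-private (inR2 (# 0)) (inR2 (# 3)) ((λ ()) ∘ inj) (agrees (# 0) (# 3)) hx ax
      extend : f (# 1) ~ x ⊎ f (# 1) ≁ x → ⊥
      extend (inj₁ bx) = noQ3-led-P4 hx (inR2 (# 1)) (inR2 (# 2)) (inR2 (# 3))
        (adj-comm bx) (adj-comm cx) (adj-comm dx) (agrees (# 1) (# 2)) (agrees (# 1) (# 3)) (agrees (# 2) (# 3))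
      extend (inj₂ bx) = noQ3-led-P4 hx (inR2 (# 0)) (inR2 (# 1)) (inR2 (# 2))
        (adj-comm ax) (adj-comm bx) (adj-comm cx) (agrees (# 0) (# 1)) (agrees (# 0) (# 2)) (agrees (# 1) (# 2))

  Among3 : V → V → V → V → Set
  Among3 a b c y = y ≡ a ⊎ y ≡ b ⊎ y ≡ c

  among3-elim : ∀ {a b c} (Prop : V → Set) → Prop a → Prop b → Prop c → ∀ {y} → Among3 a b c y → Prop y
  among3-elim Prop pa pb pc (inj₁ refl) = pa
  among3-elim Prop pa pb pc (inj₂ (inj₁ refl)) = pb
  among3-elim Prop pa pb pc (inj₂ (inj₂ refl)) = pc

  -- A Q3-neighbour x of the end a of an induced P3 a b c in R2 sees an edge pq of
  -- the P3 at q only: pq = bc if x ~ b (x misses c by (a)), and pq = ba otherwise.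
  pendantEdge : ∀ {a b c x} → a ∈ R2 → c ∈ R2 → a ~ b → b ~ c → a ≁ c → a ≢ c →
    x ∈ Q3 → a ~ x → ∃₂ λ p q → Among3 a b c p × Among3 a b c q × p ~ q × q ~ x × p ≁ x
  pendantEdge {a} {b} {c} {x} ha hc ab bc ac a≢c hx ax with adjacent? b x
  ... | inj₁ bx = c , b , inj₂ (inj₂ refl) , inj₂ (inj₁ refl) , adj-comm bc , bx , Q3-private ha hc a≢c ac hx ax
  ... | inj₂ bx = b , a , inj₂ (inj₁ refl) , inj₁ refl , adj-comm ab , ax , bx

  -- Let a b c and d e f be the two induced P3s in R2, x and x′ Q3-neighbours
  -- of a and d.  By (a), x misses d e f and x′ misses a b c; so x ≠ x′ and x ~ x′.
  -- With the pendant edges pq and p′q′ of the two P3s, p q x x′ q′ p′ is an induced P6.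
  R2-2P3-free : FreeIn G (_∈ R2) 6 twoP3
  R2-2P3-free (f , inj , inR2 , agrees) = join (R2-nbrQ3 (inR2 (# 0))) (R2-nbrQ3 (inR2 (# 3)))
    where
    First Second : V → Set
    First = Among3 (f (# 0)) (f (# 1)) (f (# 2))
    Second = Among3 (f (# 3)) (f (# 4)) (f (# 5))

    first≁second : ∀ {y} → First y → ∀ {z} → Second z → y ≁ z
    first≁second = among3-elim (λ y → ∀ {z} → Second z → y ≁ z)
      (among3-elim (f (# 0) ≁_) (agrees (# 0) (# 3)) (agrees (# 0) (# 4)) (agrees (# 0) (# 5)))
      (among3-elim (f (# 1) ≁_) (agrees (# 1) (# 3)) (agrees (# 1) (# 4)) (agrees (# 1) (# 5)))
      (among3-elim (f (# 2) ≁_) (agrees (# 2) (# 3)) (agrees (# 2) (# 4)) (agrees (# 2) (# 5)))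

    missedBy : ∀ {x} i k → i ≢ k → f i ≁ f k → x ∈ Q3 → f i ~ x → f k ≁ x
    missedBy i k i≢k ik = Q3-private (inR2 i) (inR2 k) (i≢k ∘ inj) ik

    join : ∃ (λ x → x ∈ Q3 × f (# 0) ~ x) → ∃ (λ x′ → x′ ∈ Q3 × f (# 3) ~ x′) → ⊥
    join (x , hx , ax) (x′ , hx′ , dx′) =
      close (pendantEdge (inR2 (# 0)) (inR2 (# 2)) (agrees (# 0) (# 1)) (agrees (# 1) (# 2))
                         (agrees (# 0) (# 2)) ((λ ()) ∘ inj) hx ax)
            (pendantEdge (inR2 (# 3)) (inR2 (# 5)) (agrees (# 3) (# 4)) (agrees (# 4) (# 5))
                         (agrees (# 3) (# 5)) ((λ ()) ∘ inj) hx′ dx′)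
      where
      second≁x : ∀ {z} → Second z → z ≁ x
      second≁x = among3-elim (_≁ x) (missedBy (# 0) (# 3) (λ ()) (agrees (# 0) (# 3)) hx ax)
        (missedBy (# 0) (# 4) (λ ()) (agrees (# 0) (# 4)) hx ax)
        (missedBy (# 0) (# 5) (λ ()) (agrees (# 0) (# 5)) hx ax)

      first≁x′ : ∀ {y} → First y → y ≁ x′
      first≁x′ = among3-elim (_≁ x′) (missedBy (# 3) (# 0) (λ ()) (agrees (# 3) (# 0)) hx′ dx′)
        (missedBy (# 3) (# 1) (λ ()) (agrees (# 3) (# 1)) hx′ dx′)
        (missedBy (# 3) (# 2) (λ ()) (agrees (# 3) (# 2)) hx′ dx′)

      xx′ : x ~ x′
      xx′ = Q3~Q3 hx hx′ (separatedBy dx′ (second≁x (inj₁ refl)) ∘ ≡-sym)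

      close : (∃₂ λ p q → First p × First q × p ~ q × q ~ x × p ≁ x) →
              (∃₂ λ p′ q′ → Second p′ × Second q′ × p′ ~ q′ × q′ ~ x′ × p′ ≁ x′) → ⊥
      close (p , q , p∈ , q∈ , pq , qx , px) (p′ , q′ , p′∈ , q′∈ , p′q′ , q′x′ , p′x′) =
        P6-free (path6 (p ∷ q ∷ x ∷ x′ ∷ q′ ∷ p′ ∷ [])
          ( (pq , px , first≁x′ p∈ , first≁second p∈ q′∈ , first≁second p∈ p′∈)
          , (qx , first≁x′ q∈ , first≁second q∈ q′∈ , first≁second q∈ p′∈)
          , (xx′ , adj-comm (second≁x q′∈) , adj-comm (second≁x p′∈))
          , (adj-comm q′x′ , adj-comm p′x′)
          , adj-comm p′q′ , tt))

module _ (G : Graph) (part : Vertex G → Part) (B : IsBelt G part) where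
  open Mirror G part B using (part′; belt′; to′)
  private
    module Side2 = Consequences G part B
    module Side3 = Consequences G part′ belt′

  noCommonNbr : ∀ j u v → In G part (Rj j) u → In G part (Rj j) v → u ≢ v → adj G u v ≡ false →
    ¬ (∃ λ w → In G part (Qother j) w × adj G u w ≡ true × adj G v w ≡ true)
  noCommonNbr j2 u v hu hv u≢v uv (w , hw , uw , vw) = Side2.R2-noCommonQ3 hu hv u≢v uv hw uw vw
  noCommonNbr j3 u v hu hv u≢v uv (w , hw , uw , vw) = Side2.R3-noCommonQ2 hu hv u≢v uv hw uw vw

  reachingQ : ∀ j v → In G part (Qj j) v → (∃ λ w → In G part (Rother j) w × adj G v w ≡ true) →
    ∀ x → In G part (Qother j) x → adj G v x ≡ true
  reachingQ j2 v hv (w , hw , vw) x hx = Side2.Q2-reaching-R3 hv hw vw hx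
  reachingQ j3 v hv (w , hw , vw) x hx = Side3.Q2-reaching-R3 (to′ hv) (to′ hw) vw (to′ hx)

  R-free : ∀ j → FreeIn G (In G part (Rj j)) 4 (P 4) × FreeIn G (In G part (Rj j)) 6 twoP3
  R-free j2 = Side2.R2-P4-free , Side2.R2-2P3-free
  R-free j3 = freeIn-mono {G = G} (λ v → to′ {R2} {v}) Side3.R2-P4-free , freeIn-mono {G = G} (λ v → to′ {R2} {v}) Side3.R2-2P3-free

theorem4p1 : (G : Graph) (part : Vertex G → Part) → IsBelt G part →
    -- (a)
    (∀ j u v → In G part (Rj j) u → In G part (Rj j) v → u ≢ v → adj G u v ≡ false →
       ¬ (∃ λ w → In G part (Qother j) w × adj G u w ≡ true × adj G v w ≡ true))
    -- (b)
    × (∀ u v → In G part R2 u → In G part R3 v → adj G u v ≡ false)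
    -- (c)
    × (∀ j v → In G part (Qj j) v → (∃ λ w → In G part (Rother j) w × adj G v w ≡ true) →
       ∀ x → In G part (Qother j) x → adj G v x ≡ true)
    -- (d)
    × (∀ j → FreeIn G (In G part (Rj j)) 4 (P 4) × FreeIn G (In G part (Rj j)) 6 twoP3)
theorem4p1 G part B =
  noCommonNbr G part B , (λ u v → Consequences.R2≁R3 G part B) , reachingQ G part B , R-free G part B
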